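{- Let $m_1,m_2,N\in\mathbb{N}$ and let $i\ge 2$ be an integer with $m_1+m_2\le\binom{N}{i-1}$. Then \[ \left(m_1+m_2+\binom{N}{i}\right)^{(i)}\ge m_1^{(i-1)}+m_2^{(i-1)}+\binom{N}{i+1}. \]
   Context: $\mathbb{N}=\{1,2,3,\dots\}$. For $m,j\in\mathbb{N}$ there is a unique representation $m=\binom{n_j}{j}+\binom{n_{j-1}}{j-1}+\cdots+\binom{n_t}{t}$ with $n_j>n_{j-1}>\cdots>n_t\ge t\ge 1$, and the upper $j$-boundary is $m^{(j)}=\binom{n_j}{j+1}+\binom{n_{j-1}}{j}+\cdots+\binom{n_t}{t+1}$. -}

module Defs where

open import Data.Nat using (ℕ; zero; suc; _∸_; _+_; _≤?_)
open import Data.Nat.Combinatorics using (_C_)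
open import Relation.Nullary using (yes; no)

topBelow : ℕ → ℕ → ℕ → ℕ
topBelow j m zero = zero
topBelow j m (suc k) with (suc k) C j ≤? m
... | yes _ = suc k
... | no  _ = topBelow j m k

-- greedy leading index n_j of the j-binomial (Macaulay) representation of m:
-- the largest n with (n C j) ≤ m.  Since ((m + j) C j) > m for j ≥ 1,
-- searching n ≤ m + j suffices.
lead : ℕ → ℕ → ℕ
lead j m = topBelow j m (m + j)

-- upper j-boundary  m^(j) :
-- if m = C(n_j,j) + C(n_{j-1},j-1) + ... + C(n_t,t)  (n_j > ... > n_t ≥ t ≥ 1)
-- then m^(j) = C(n_j,j+1) + ... + C(n_t,t+1).
-- Computed by the greedy algorithm, which produces exactly the unique representation.
-- (Empty sum, i.e. m = 0, gives 0; j = 0 is never reached for m > 0.)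
upper : ℕ → ℕ → ℕ
upper zero    m       = zero
upper (suc j) zero    = zero
upper (suc j) (suc m) =
  (lead (suc j) (suc m) C (suc (suc j))) + upper j (suc m ∸ (lead (suc j) (suc m) C suc j))

_^⟨_⟩ : ℕ → ℕ → ℕ
m ^⟨ j ⟩ = upper j m

module Submission where

-- Write u_j m = m^(j).  Greedily, m = C(n,1+j) + r with r < C(n,j), and then
--   u_(1+j) (C(n,1+j) + r) = C(n,2+j) + u_j r                             (peeling)
-- (for j ≥ 1 this even holds for r = C(n,j), by Pascal's rule).  Lemma 2 follows at
-- once from peeling and the superadditivity  u_j a + u_j b ≤ u_j (a + b)  of level i - 1.
--
-- Superadditivity is proved by induction on the level, together with an exchange law:
-- whenever z + p + q = C(n,j), u_j (z+p) + u_j (z+q) ≤ u_j (C(n,j)) + u_j z.  At level 1,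
-- u_1 m = C(m,2) and both laws are elementary.  Passing from g = u_(1+j) to f = u_(2+j),
-- an inner induction on the block index n proves exchange for f at C(n,2+j) simultaneously
-- with a cross-level exchange between f and g; then f ≤ g, and superadditivity of f
-- follows by strong induction, using exchange at the block boundary that a + b crosses.

open import Defs
open import Data.Nat using (ℕ; zero; suc; _+_; _≤_; _≥_; _<_; _∸_; z≤n; s≤s; z<s; _≤?_; _<?_)
open import Data.Nat.Combinatorics using (_C_; nC1≡n; nCn≡1; k>n⇒nCk≡0; nCk+nC[k+1]≡[n+1]C[k+1])
open import Data.Nat.Induction using (<-rec)
open import Data.Nat.Properties
open import Algebra.Properties.CommutativeSemigroup +-commutativeSemigroup
  using (interchange; xy∙z≈xz∙y; x∙yz≈xz∙y; x∙yz≈y∙xz)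
open import Data.Nat.Tactic.RingSolver using (solve-∀)
open import Data.Product using (Σ-syntax; _×_; _,_; proj₁; proj₂)
open import Data.Sum using (inj₁; inj₂)
open import Relation.Binary.PropositionalEquality
open import Relation.Nullary using (yes; no)
open import Relation.Nullary.Negation using (contradiction)

pascal : ∀ n k → suc n C suc k ≡ n C k + n C suc k
pascal n k = sym (nCk+nC[k+1]≡[n+1]C[k+1] n k)

C-positive : ∀ {n k} → k ≤ n → 1 ≤ n C k
C-positive {n} {zero} _ = ≤-refl
C-positive {suc n} {suc k} (s≤s k≤n) =
  subst (1 ≤_) (sym (pascal n k)) (≤-trans (C-positive k≤n) (m≤m+n _ _))

C≡0⇒< : ∀ {n k} → n C k ≡ 0 → n < k
C≡0⇒< {n} {k} nCk≡0 with k ≤? n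
... | yes k≤n = contradiction (subst (1 ≤_) nCk≡0 (C-positive k≤n)) λ ()
... | no k≰n = ≰⇒> k≰n

C≡0⇒C-suc≡0 : ∀ n k → n C k ≡ 0 → n C suc k ≡ 0
C≡0⇒C-suc≡0 n k nCk≡0 = k>n⇒nCk≡0 (m<n⇒m<1+n (C≡0⇒< {n} {k} nCk≡0))

C-monoˡ-suc : ∀ n k → n C k ≤ suc n C k
C-monoˡ-suc n zero = ≤-refl
C-monoˡ-suc n (suc k) = subst (n C suc k ≤_) (sym (pascal n k)) (m≤n+m _ _)

C-monoˡ : ∀ k {n m} → n ≤ m → n C k ≤ m C k
C-monoˡ k {m = zero} z≤n = ≤-refl
C-monoˡ k {n} {suc m} n≤1+m with m≤n⇒m<n∨m≡n n≤1+m
... | inj₁ (s≤s n≤m) = ≤-trans (C-monoˡ k n≤m) (C-monoˡ-suc m k)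
... | inj₂ refl = ≤-refl

-- A crude bound showing that the search range  m + (1 + j)  used by  lead  is large enough.
search-bound : ∀ n j → n ≤ n C suc j + suc j
search-bound zero j = z≤n
search-bound (suc n) j with j ≤? n
... | yes j≤n = begin
  suc n                       ≤⟨ s≤s (search-bound n j) ⟩
  1 + n C suc j + suc j       ≤⟨ +-monoˡ-≤ (suc j) (+-monoˡ-≤ (n C suc j) (C-positive j≤n)) ⟩
  n C j + n C suc j + suc j   ≡⟨ cong (_+ suc j) (sym (pascal n j)) ⟩
  suc n C suc j + suc j       ∎
  where open ≤-Reasoning
... | no j≰n = ≤-trans (≰⇒> j≰n) (≤-trans (n≤1+n j) (m≤n+m (suc j) _))

topBelow-spec : ∀ j m K n → n ≤ K → n C j ≤ m → (∀ k → n < k → k ≤ K → m < k C j) →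
                topBelow j m K ≡ n
topBelow-spec j m zero n n≤0 _ _ = sym (n≤0⇒n≡0 n≤0)
topBelow-spec j m (suc K) n n≤1+K fits above with suc K C j ≤? m | m≤n⇒m<n∨m≡n n≤1+K
... | yes fitsK | inj₁ n<1+K = contradiction fitsK (<⇒≱ (above (suc K) n<1+K ≤-refl))
... | yes _     | inj₂ n≡1+K = sym n≡1+K
... | no _      | inj₁ (s≤s n≤K) =
  topBelow-spec j m K n n≤K fits λ k n<k k≤K → above k n<k (m≤n⇒m≤1+n k≤K)
... | no misfit | inj₂ refl = contradiction fits misfit

lead-spec : ∀ j m n → n C suc j ≤ m → m < suc n C suc j → lead (suc j) m ≡ n
lead-spec j m n fits m<next = topBelow-spec (suc j) m (m + suc j) n
  (≤-trans (search-bound n j) (+-monoˡ-≤ (suc j) fits)) fits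
  (λ k n<k _ → <-≤-trans m<next (C-monoˡ (suc j) n<k))

upper-zero : ∀ j → upper j 0 ≡ 0
upper-zero zero = refl
upper-zero (suc j) = refl

upper-peel : ∀ j n r → r < n C j → upper (suc j) (n C suc j + r) ≡ n C suc (suc j) + upper j r
upper-peel j n r r<C = peel (n C suc j + r) refl
  where
  peel : ∀ m → n C suc j + r ≡ m → upper (suc j) m ≡ n C suc (suc j) + upper j r
  peel zero sum≡0 = begin
    0                             ≡⟨ sym (k>n⇒nCk≡0 (m<n⇒m<1+n n<1+j)) ⟩
    n C suc (suc j)               ≡⟨ sym (+-identityʳ _) ⟩
    n C suc (suc j) + 0           ≡⟨ cong (λ x → n C suc (suc j) + x) (sym (upper-zero j)) ⟩
    n C suc (suc j) + upper j 0   ≡⟨ cong (λ x → n C suc (suc j) + upper j x) (sym (m+n≡0⇒n≡0 (n C suc j) sum≡0)) ⟩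
    n C suc (suc j) + upper j r   ∎
    where
    open ≡-Reasoning
    n<1+j : n < suc j
    n<1+j = C≡0⇒< (m+n≡0⇒m≡0 (n C suc j) sum≡0)
  peel (suc m) sum≡1+m = begin
    lead (suc j) (suc m) C suc (suc j) + upper j (suc m ∸ lead (suc j) (suc m) C suc j)
      ≡⟨ cong (λ x → x C suc (suc j) + upper j (suc m ∸ x C suc j)) lead≡n ⟩
    n C suc (suc j) + upper j (suc m ∸ n C suc j)
      ≡⟨ cong (λ x → n C suc (suc j) + upper j (x ∸ n C suc j)) (sym sum≡1+m) ⟩
    n C suc (suc j) + upper j (n C suc j + r ∸ n C suc j)
      ≡⟨ cong (λ x → n C suc (suc j) + upper j x) (m+n∸m≡n (n C suc j) r) ⟩
    n C suc (suc j) + upper j r ∎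
    where
    open ≡-Reasoning
    below : suc m < suc n C suc j
    below = subst₂ _<_ sum≡1+m (trans (+-comm (n C suc j) (n C j)) (sym (pascal n j)))
                   (+-monoʳ-< (n C suc j) r<C)
    lead≡n : lead (suc j) (suc m) ≡ n
    lead≡n = lead-spec j (suc m) n (subst (n C suc j ≤_) sum≡1+m (m≤m+n _ _)) below

greedy-split : ∀ j m → Σ[ n ∈ ℕ ] Σ[ r ∈ ℕ ] (m ≡ n C suc j + r) × (r < n C j)
greedy-split j zero =
  j , 0 , sym (trans (+-identityʳ _) (k>n⇒nCk≡0 (n<1+n j))) , subst (0 <_) (sym (nCn≡1 j)) z<s
greedy-split j (suc m) with greedy-split j m
... | n , r , m≡ , r<C with suc r <? n C j
...   | yes 1+r<C = n , suc r , trans (cong suc m≡) (sym (+-suc _ r)) , 1+r<C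
...   | no 1+r≮C = suc n , 0 , 1+m≡ , 0<C
  where
  1+r≡C : suc r ≡ n C j
  1+r≡C = ≤-antisym r<C (≮⇒≥ 1+r≮C)
  1+m≡ : suc m ≡ suc n C suc j + 0
  1+m≡ = begin
    suc m                    ≡⟨ cong suc m≡ ⟩
    suc (n C suc j + r)      ≡⟨ sym (+-suc _ r) ⟩
    n C suc j + suc r        ≡⟨ cong (n C suc j +_) 1+r≡C ⟩
    n C suc j + n C j        ≡⟨ +-comm (n C suc j) (n C j) ⟩
    n C j + n C suc j        ≡⟨ sym (pascal n j) ⟩
    suc n C suc j            ≡⟨ sym (+-identityʳ _) ⟩
    suc n C suc j + 0        ∎
    where open ≡-Reasoning
  0<C : 0 < suc n C j
  0<C = ≤-trans (subst (1 ≤_) 1+r≡C (s≤s z≤n)) (C-monoˡ-suc n j)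

upper-binomial : ∀ j n → upper (suc j) (n C suc j) ≡ n C suc (suc j)
upper-binomial j n with 0 <? n C j
... | yes 0<C = begin
  upper (suc j) (n C suc j)           ≡⟨ cong (upper (suc j)) (sym (+-identityʳ (n C suc j))) ⟩
  upper (suc j) (n C suc j + 0)       ≡⟨ upper-peel j n 0 0<C ⟩
  n C suc (suc j) + upper j 0         ≡⟨ cong (n C suc (suc j) +_) (upper-zero j) ⟩
  n C suc (suc j) + 0                 ≡⟨ +-identityʳ _ ⟩
  n C suc (suc j)                     ∎
  where open ≡-Reasoning
... | no 0≮C = begin
  upper (suc j) (n C suc j)   ≡⟨ cong (upper (suc j)) (k>n⇒nCk≡0 (m<n⇒m<1+n n<j)) ⟩
  0                           ≡⟨ sym (k>n⇒nCk≡0 (m<n⇒m<1+n (m<n⇒m<1+n n<j))) ⟩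
  n C suc (suc j)             ∎
  where
  open ≡-Reasoning
  n<j : n < j
  n<j = C≡0⇒< (n≤0⇒n≡0 (≮⇒≥ 0≮C))

-- From level 1 on, peeling also works in the boundary case  r = C(n,1+j),
-- where  C(n,2+j) + r = C(1+n,2+j)  by Pascal's rule.
upper-peel≤ : ∀ j n r → r ≤ n C suc j →
  upper (suc (suc j)) (n C suc (suc j) + r) ≡ n C suc (suc (suc j)) + upper (suc j) r
upper-peel≤ j n r r≤C with m≤n⇒m<n∨m≡n r≤C
... | inj₁ r<C = upper-peel (suc j) n r r<C
... | inj₂ refl = begin
  upper (suc (suc j)) (n C suc (suc j) + n C suc j)
    ≡⟨ cong (upper (suc (suc j))) (trans (+-comm (n C suc (suc j)) (n C suc j)) (sym (pascal n (suc j)))) ⟩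
  upper (suc (suc j)) (suc n C suc (suc j))       ≡⟨ upper-binomial (suc j) (suc n) ⟩
  suc n C suc (suc (suc j))                       ≡⟨ pascal n (suc (suc j)) ⟩
  n C suc (suc j) + n C suc (suc (suc j))         ≡⟨ +-comm (n C suc (suc j)) _ ⟩
  n C suc (suc (suc j)) + n C suc (suc j)         ≡⟨ cong (n C suc (suc (suc j)) +_) (sym (upper-binomial j n)) ⟩
  n C suc (suc (suc j)) + upper (suc j) (n C suc j) ∎
  where open ≡-Reasoning

upper-one : ∀ m → upper 1 m ≡ m C 2
upper-one m = begin
  upper 1 m            ≡⟨ cong (upper 1) (sym (trans (+-identityʳ _) (nC1≡n m))) ⟩
  upper 1 (m C 1 + 0)  ≡⟨ upper-peel 0 m 0 z<s ⟩
  m C 2 + 0            ≡⟨ +-identityʳ _ ⟩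
  m C 2                ∎
  where open ≡-Reasoning

Superadditive : (ℕ → ℕ) → Set
Superadditive u = ∀ a b → u a + u b ≤ u (a + b)

ExchangeAt : (ℕ → ℕ) → ℕ → Set
ExchangeAt u T = ∀ z p q → z + p + q ≡ T → u (z + p) + u (z + q) ≤ u T + u z

TopExchange : (ℕ → ℕ) → ℕ → ℕ → Set
TopExchange u c c' = ∀ w k → w + k ≡ c → u c + u (w + c') ≤ u (c + c') + u w

-- Removing k from C costs f at most what removing k from C' costs g:
-- f C - f (C - k) ≤ g C' - g (C' - k).
CrossExchange : (ℕ → ℕ) → (ℕ → ℕ) → ℕ → ℕ → Set
CrossExchange f g C C' = ∀ k w v → w + k ≡ C → v + k ≡ C' → f C + g v ≤ g C' + f w

exchange-at-zero : ∀ u → ExchangeAt u 0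
exchange-at-zero u zero    zero    zero    _ = ≤-refl
exchange-at-zero u zero    zero    (suc _) ()
exchange-at-zero u zero    (suc _) _       ()
exchange-at-zero u (suc _) _       _       ()

cross-exchange-at-zero : ∀ f g C' → CrossExchange f g 0 C'
cross-exchange-at-zero f g .(v + 0) zero zero v refl refl =
  ≤-reflexive (trans (+-comm (f 0) (g v)) (cong (λ x → g x + f 0) (sym (+-identityʳ v))))
cross-exchange-at-zero f g C' zero    (suc _) v () _
cross-exchange-at-zero f g C' (suc k) zero    v () _
cross-exchange-at-zero f g C' (suc k) (suc _) v () _

-- Exchange with empty overlap is superadditivity.
exchange⇒superadditive : ∀ u → u 0 ≡ 0 → (∀ T → ExchangeAt u T) → Superadditive u
exchange⇒superadditive u u0≡0 exchange a b =
  subst (u a + u b ≤_) (trans (cong (u (a + b) +_) u0≡0) (+-identityʳ _)) (exchange (a + b) 0 a b refl)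

-- Top exchange is the instance z = w, p = c', q = k of exchange.
exchange⇒top-exchange : ∀ u c c' → ExchangeAt u (c + c') → TopExchange u c c'
exchange⇒top-exchange u c c' exchange w k w+k≡c =
  subst₂ _≤_ (trans (+-comm (u (w + c')) _) (cong (λ x → u x + u (w + c')) w+k≡c)) refl
    (exchange w c' k (trans (xy∙z≈xz∙y w c' k) (cong (_+ c') w+k≡c)))

C2-suc : ∀ x → suc x C 2 ≡ x C 2 + x
C2-suc x = trans (pascal x 1) (trans (cong (_+ x C 2) (nC1≡n x)) (+-comm x _))

-- (z+p)C2 + (z+q)C2 ≤ (z+p+q)C2 + zC2; the difference is p·q.
C2-exchange : ∀ T → ExchangeAt (_C 2) T
C2-exchange T z p q refl = exchange q
  where
  regroup : ∀ a b z p q → a + b + (z + (p + q)) ≡ (a + (z + p + q)) + b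
  regroup = solve-∀
  exchange : ∀ q → (z + p) C 2 + (z + q) C 2 ≤ (z + p + q) C 2 + z C 2
  exchange zero = ≤-reflexive (cong₂ _+_ (cong (_C 2) (sym (+-identityʳ (z + p)))) (cong (_C 2) (+-identityʳ z)))
  exchange (suc q) = begin
    (z + p) C 2 + (z + suc q) C 2            ≡⟨ cong (λ x → (z + p) C 2 + x C 2) (+-suc z q) ⟩
    (z + p) C 2 + suc (z + q) C 2            ≡⟨ cong ((z + p) C 2 +_) (C2-suc (z + q)) ⟩
    (z + p) C 2 + ((z + q) C 2 + (z + q))    ≡⟨ sym (+-assoc ((z + p) C 2) _ _) ⟩
    (z + p) C 2 + (z + q) C 2 + (z + q)      ≤⟨ +-mono-≤ (exchange q) (+-monoʳ-≤ z (m≤n+m q p)) ⟩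
    (z + p + q) C 2 + z C 2 + (z + (p + q))  ≡⟨ regroup ((z + p + q) C 2) (z C 2) z p q ⟩
    ((z + p + q) C 2 + (z + p + q)) + z C 2  ≡⟨ cong (_+ z C 2) (sym (C2-suc (z + p + q))) ⟩
    suc (z + p + q) C 2 + z C 2              ≡⟨ cong (λ x → x C 2 + z C 2) (sym (+-suc (z + p) q)) ⟩
    (z + p + suc q) C 2 + z C 2              ∎
    where open ≤-Reasoning

upper-one-exchange : ∀ T → ExchangeAt (upper 1) T
upper-one-exchange T z p q sum≡T
  rewrite upper-one (z + p) | upper-one (z + q) | upper-one T | upper-one z
  = C2-exchange T z p q sum≡T

module NextLevel (j : ℕ)
  (g-superadditive : Superadditive (upper (suc j)))
  (g-exchange : ∀ n → ExchangeAt (upper (suc j)) (n C suc j)) where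

  g f : ℕ → ℕ
  g = upper (suc j)
  f = upper (suc (suc j))

  -- the binomial rows that delimit the blocks on which f and g peel
  c₀ c₁ c₂ : ℕ → ℕ
  c₀ n = n C j
  c₁ n = n C suc j
  c₂ n = n C suc (suc j)

  c₁-suc : ∀ n → c₁ (suc n) ≡ c₁ n + c₀ n
  c₁-suc n = trans (pascal n j) (+-comm (c₀ n) (c₁ n))

  c₂-suc : ∀ n → c₂ (suc n) ≡ c₂ n + c₁ n
  c₂-suc n = trans (pascal n (suc j)) (+-comm (c₁ n) (c₂ n))

  f-peel : ∀ n r → r ≤ c₁ n → f (c₂ n + r) ≡ f (c₂ n) + g r
  f-peel n r r≤c₁ = trans (upper-peel≤ j n r r≤c₁) (cong (_+ g r) (sym (upper-binomial (suc j) n)))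

  -- Top exchange for g, from exchange for g at the next block C(1+n,1+j) = c₁ n + c₀ n.
  g-top : ∀ n → TopExchange g (c₁ n) (c₀ n)
  g-top n = exchange⇒top-exchange g (c₁ n) (c₀ n) (subst (ExchangeAt g) (c₁-suc n) (g-exchange (suc n)))

  -- Top exchange for f at block n: if k ≤ c₁ n, by peeling and cross exchange; otherwise
  -- by exchange for f at c₂ n combined with cross exchange for the part beyond c₁ n.
  f-top : ∀ n → ExchangeAt f (c₂ n) → CrossExchange f g (c₂ n) (c₁ n) → TopExchange f (c₂ n) (c₁ n)
  f-top n exchange cross w k w+k≡c₂ with k ≤? c₁ n
  ... | yes k≤c₁ =
    let v , k+v≡c₁ = m≤n⇒∃[o]m+o≡n k≤c₁
        w+c₁≡c₂+v = trans (cong (w +_) (sym k+v≡c₁)) (trans (sym (+-assoc w k v)) (cong (_+ v) w+k≡c₂))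
    in begin
    f (c₂ n) + f (w + c₁ n)         ≡⟨ cong (λ x → f (c₂ n) + f x) w+c₁≡c₂+v ⟩
    f (c₂ n) + f (c₂ n + v)         ≡⟨ cong (f (c₂ n) +_) (f-peel n v (subst (v ≤_) k+v≡c₁ (m≤n+m v k))) ⟩
    f (c₂ n) + (f (c₂ n) + g v)     ≤⟨ +-monoʳ-≤ (f (c₂ n)) (cross k w v w+k≡c₂ (trans (+-comm v k) k+v≡c₁)) ⟩
    f (c₂ n) + (g (c₁ n) + f w)     ≡⟨ sym (+-assoc (f (c₂ n)) _ _) ⟩
    f (c₂ n) + g (c₁ n) + f w       ≡⟨ cong (_+ f w) (sym (f-peel n (c₁ n) ≤-refl)) ⟩
    f (c₂ n + c₁ n) + f w           ∎
    where open ≤-Reasoning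
  ... | no k≰c₁ =
    let u , c₁+u≡k = m≤n⇒∃[o]m+o≡n (<⇒≤ (≰⇒> k≰c₁))
        w+c₁+u≡c₂ = trans (+-assoc w (c₁ n) u) (trans (cong (w +_) c₁+u≡k) w+k≡c₂)
        w+u+c₁≡c₂ = trans (xy∙z≈xz∙y w u (c₁ n)) w+c₁+u≡c₂
    in +-cancelʳ-≤ (f (w + u)) _ _ (begin
    f (c₂ n) + f (w + c₁ n) + f (w + u)           ≡⟨ trans (+-assoc (f (c₂ n)) _ _) (+-comm (f (c₂ n)) _) ⟩
    (f (w + c₁ n) + f (w + u)) + f (c₂ n)         ≤⟨ +-mono-≤ (exchange w (c₁ n) u w+c₁+u≡c₂)
                                                              (≤-trans (m≤m+n _ _) (cross (c₁ n) (w + u) 0 w+u+c₁≡c₂ refl)) ⟩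
    (f (c₂ n) + f w) + (g (c₁ n) + f (w + u))     ≡⟨ regroup (f (c₂ n)) (f w) (g (c₁ n)) (f (w + u)) ⟩
    (f (c₂ n) + g (c₁ n) + f w) + f (w + u)       ≡⟨ cong (λ x → x + f w + f (w + u)) (sym (f-peel n (c₁ n) ≤-refl)) ⟩
    f (c₂ n + c₁ n) + f w + f (w + u)             ∎)
    where
    open ≤-Reasoning
    regroup : ∀ a b c d → (a + b) + (c + d) ≡ (a + c + b) + d
    regroup = solve-∀

  c₁-positive : ∀ m {k} → c₁ m < k → k ≤ c₂ m + c₁ m → 0 < c₁ m
  c₁-positive m {k} c₁<k k≤T = n≢0⇒n>0 λ c₁≡0 →
    <⇒≱ (subst (_< k) c₁≡0 c₁<k) (subst (k ≤_) (cong₂ _+_ (C≡0⇒C-suc≡0 m (suc j) c₁≡0) c₁≡0) k≤T)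

  f-cross-suc : ∀ m → TopExchange f (c₂ m) (c₁ m) → CrossExchange f g (c₂ m + c₁ m) (c₁ m + c₀ m)
  f-cross-suc m f-top-m k = <-rec Goal cross k
    where
    open ≤-Reasoning
    T T' : ℕ
    T = c₂ m + c₁ m
    T' = c₁ m + c₀ m
    Goal : ℕ → Set
    Goal k = ∀ w v → w + k ≡ T → v + k ≡ T' → f T + g v ≤ g T' + f w
    -- If k ≤ c₁ m, everything happens inside block m and reduces to the top exchange of g.
    -- Otherwise first remove c₁ m (the induction hypothesis with k - c₁ m) and then the rest.
    cross : ∀ k → (∀ {k'} → k' < k → Goal k') → Goal k
    cross k rec w v w+k≡T v+k≡T' with k ≤? c₁ m
    ... | yes k≤c₁ =
      let s , k+s≡c₁ = m≤n⇒∃[o]m+o≡n k≤c₁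
          w≡c₂+s = +-cancelʳ-≡ k w (c₂ m + s)
                     (trans w+k≡T (trans (cong (c₂ m +_) (sym k+s≡c₁)) (x∙yz≈xz∙y (c₂ m) k s)))
          v≡s+c₀ = +-cancelʳ-≡ k v (s + c₀ m)
                     (trans v+k≡T' (trans (cong (_+ c₀ m) (trans (sym k+s≡c₁) (+-comm k s))) (xy∙z≈xz∙y s k (c₀ m))))
      in begin
      f T + g v                               ≡⟨ cong₂ _+_ (f-peel m (c₁ m) ≤-refl) (cong g v≡s+c₀) ⟩
      f (c₂ m) + g (c₁ m) + g (s + c₀ m)      ≡⟨ +-assoc (f (c₂ m)) _ _ ⟩
      f (c₂ m) + (g (c₁ m) + g (s + c₀ m))    ≤⟨ +-monoʳ-≤ (f (c₂ m)) (g-top m s k (trans (+-comm s k) k+s≡c₁)) ⟩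
      f (c₂ m) + (g T' + g s)                 ≡⟨ x∙yz≈y∙xz (f (c₂ m)) (g T') (g s) ⟩
      g T' + (f (c₂ m) + g s)                 ≡⟨ cong (g T' +_) (sym (f-peel m s (subst (s ≤_) k+s≡c₁ (m≤n+m s k)))) ⟩
      g T' + f (c₂ m + s)                     ≡⟨ cong (λ x → g T' + f x) (sym w≡c₂+s) ⟩
      g T' + f w                              ∎
    ... | no k≰c₁ =
      let c₁<k = ≰⇒> k≰c₁
          u , c₁+u≡k = m≤n⇒∃[o]m+o≡n (<⇒≤ c₁<k)
          w+c₁+u≡T = trans (+-assoc w (c₁ m) u) (trans (cong (w +_) c₁+u≡k) w+k≡T)
          v+c₁+u≡T' = trans (+-assoc v (c₁ m) u) (trans (cong (v +_) c₁+u≡k) v+k≡T')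
          w+u≡c₂ = +-cancelʳ-≡ (c₁ m) (w + u) (c₂ m) (trans (xy∙z≈xz∙y w u (c₁ m)) w+c₁+u≡T)
          u<k = subst (u <_) c₁+u≡k (m<n+m u (c₁-positive m c₁<k (subst (k ≤_) w+k≡T (m≤n+m k w))))
          -- the top exchange of f at block m, with f (c₂ m) cancelled
          top : f (w + c₁ m) ≤ g (c₁ m) + f w
          top = +-cancelˡ-≤ (f (c₂ m)) _ _
                  (subst (f (c₂ m) + f (w + c₁ m) ≤_)
                     (trans (cong (_+ f w) (f-peel m (c₁ m) ≤-refl)) (+-assoc (f (c₂ m)) _ _))
                     (f-top-m w u w+u≡c₂))
      in +-cancelʳ-≤ (g (c₁ m)) _ _ (begin
      f T + g v + g (c₁ m)       ≡⟨ +-assoc (f T) (g v) _ ⟩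
      f T + (g v + g (c₁ m))     ≤⟨ +-monoʳ-≤ (f T) (g-superadditive v (c₁ m)) ⟩
      f T + g (v + c₁ m)         ≤⟨ rec u<k (w + c₁ m) (v + c₁ m) w+c₁+u≡T v+c₁+u≡T' ⟩
      g T' + f (w + c₁ m)        ≤⟨ +-monoʳ-≤ (g T') top ⟩
      g T' + (g (c₁ m) + f w)    ≡⟨ x∙yz≈xz∙y (g T') (g (c₁ m)) (f w) ⟩
      g T' + f w + g (c₁ m)      ∎)

  -- Exchange for f at block m+1, i.e. at total T = c₂ m + c₁ m, by cases on how the
  -- pieces z+p, z+q and their overlap z sit relative to the block boundary d = c₂ m.
  module ExchangeSuc (m : ℕ)
    (exchange-m : ExchangeAt f (c₂ m))
    (cross-m : CrossExchange f g (c₂ m) (c₁ m))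
    (top-m : TopExchange f (c₂ m) (c₁ m)) where

    open ≤-Reasoning

    d d' T : ℕ
    d = c₂ m
    d' = c₁ m
    T = d + d'

    f-T : f T ≡ f d + g d'
    f-T = f-peel m d' ≤-refl

    -- The overlap lies beyond d: exchange for g inside the block.
    above : ∀ w p q → w + p + q ≡ d' → f (d + w + p) + f (d + w + q) ≤ f T + f (d + w)
    above w p q sum = begin
      f (d + w + p) + f (d + w + q)           ≡⟨ cong₂ _+_ (peel p w+p≤d') (peel q w+q≤d') ⟩
      (f d + g (w + p)) + (f d + g (w + q))   ≡⟨ interchange (f d) _ (f d) _ ⟩
      (f d + f d) + (g (w + p) + g (w + q))   ≤⟨ +-monoʳ-≤ (f d + f d) (g-exchange m w p q sum) ⟩
      (f d + f d) + (g d' + g w)              ≡⟨ interchange (f d) (f d) (g d') (g w) ⟩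
      (f d + g d') + (f d + g w)              ≡⟨ cong₂ _+_ (sym f-T) (sym (f-peel m w (≤-trans (m≤m+n w p) w+p≤d'))) ⟩
      f T + f (d + w)                         ∎
      where
      w+p≤d' : w + p ≤ d'
      w+p≤d' = subst (w + p ≤_) sum (m≤m+n (w + p) q)
      w+q≤d' : w + q ≤ d'
      w+q≤d' = subst (w + q ≤_) (trans (xy∙z≈xz∙y w q p) sum) (m≤m+n (w + q) p)
      peel : ∀ x → w + x ≤ d' → f (d + w + x) ≡ f d + g (w + x)
      peel x w+x≤d' = trans (cong f (+-assoc d w x)) (f-peel m (w + x) w+x≤d')

    straddle : ∀ z p q k → z + p + q ≡ T → z + k ≡ d → k ≤ p → k ≤ q → f (z + p) + f (z + q) ≤ f T + f z
    straddle z p q k sum z+k≡d k≤p k≤q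
      with m≤n⇒∃[o]m+o≡n k≤p | m≤n⇒∃[o]m+o≡n k≤q
    ... | r₁ , refl | r₂ , refl = begin
      f (z + (k + r₁)) + f (z + (k + r₂))     ≡⟨ cong₂ _+_ (peel r₁ r₁≤d') (peel r₂ r₂≤d') ⟩
      (f d + g r₁) + (f d + g r₂)             ≡⟨ interchange (f d) _ (f d) _ ⟩
      (f d + f d) + (g r₁ + g r₂)             ≤⟨ +-monoʳ-≤ (f d + f d) (g-superadditive r₁ r₂) ⟩
      (f d + f d) + g (r₁ + r₂)               ≡⟨ +-assoc (f d) (f d) _ ⟩
      f d + (f d + g (r₁ + r₂))               ≤⟨ +-monoʳ-≤ (f d) (cross-m k z (r₁ + r₂) z+k≡d r₁+r₂+k≡d') ⟩
      f d + (g d' + f z)                      ≡⟨ sym (+-assoc (f d) _ _) ⟩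
      (f d + g d') + f z                      ≡⟨ cong (_+ f z) (sym f-T) ⟩
      f T + f z                               ∎
      where
      regroup : ∀ z k r₁ r₂ → (z + k) + (r₁ + r₂ + k) ≡ z + (k + r₁) + (k + r₂)
      regroup = solve-∀
      r₁+r₂+k≡d' : r₁ + r₂ + k ≡ d'
      r₁+r₂+k≡d' = +-cancelˡ-≡ d _ _ (trans (cong (_+ (r₁ + r₂ + k)) (sym z+k≡d)) (trans (regroup z k r₁ r₂) sum))
      r₁≤d' : r₁ ≤ d'
      r₁≤d' = subst (r₁ ≤_) r₁+r₂+k≡d' (≤-trans (m≤m+n r₁ r₂) (m≤m+n _ k))
      r₂≤d' : r₂ ≤ d'
      r₂≤d' = subst (r₂ ≤_) r₁+r₂+k≡d' (≤-trans (m≤n+m r₂ r₁) (m≤m+n _ k))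
      peel : ∀ r → r ≤ d' → f (z + (k + r)) ≡ f d + g r
      peel r r≤d' = trans (cong f (trans (sym (+-assoc z k r)) (cong (_+ r) z+k≡d))) (f-peel m r r≤d')

    one-side : ∀ z p q k → z + p + q ≡ T → z + k ≡ d → k ≤ p → q ≤ k → f (z + p) + f (z + q) ≤ f T + f z
    one-side z p q k sum z+k≡d k≤p q≤k with m≤n⇒∃[o]m+o≡n k≤p | m≤n⇒∃[o]m+o≡n q≤k
    ... | r , refl | s , q+s≡k = +-cancelʳ-≤ (f (z + s)) _ _ (begin
      f (z + (k + r)) + f (z + q) + f (z + s)   ≡⟨ cong (λ x → x + f (z + q) + f (z + s)) f-z+p ⟩
      (f d + g r) + f (z + q) + f (z + s)       ≡⟨ +-assoc (f d + g r) _ _ ⟩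
      (f d + g r) + (f (z + q) + f (z + s))     ≤⟨ +-monoʳ-≤ (f d + g r) (exchange-m z q s z+q+s≡d) ⟩
      (f d + g r) + (f d + f z)                 ≤⟨ +-monoˡ-≤ (f d + f z) (cross-m q (z + s) r z+s+q≡d r+q≡d') ⟩
      (g d' + f (z + s)) + (f d + f z)          ≡⟨ regroup (g d') (f (z + s)) (f d) (f z) ⟩
      (f d + g d' + f z) + f (z + s)            ≡⟨ cong (λ x → x + f z + f (z + s)) (sym f-T) ⟩
      f T + f z + f (z + s)                     ∎)
      where
      regroup : ∀ a b c e → (a + b) + (c + e) ≡ (c + a + e) + b
      regroup = solve-∀
      regroup′ : ∀ z k r q → (z + k) + (r + q) ≡ z + (k + r) + q
      regroup′ = solve-∀
      r+q≡d' : r + q ≡ d'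
      r+q≡d' = +-cancelˡ-≡ d _ _ (trans (cong (_+ (r + q)) (sym z+k≡d)) (trans (regroup′ z k r q) sum))
      z+q+s≡d : z + q + s ≡ d
      z+q+s≡d = trans (+-assoc z q s) (trans (cong (z +_) q+s≡k) z+k≡d)
      z+s+q≡d : z + s + q ≡ d
      z+s+q≡d = trans (xy∙z≈xz∙y z s q) z+q+s≡d
      f-z+p : f (z + (k + r)) ≡ f d + g r
      f-z+p = trans (cong f (trans (sym (+-assoc z k r)) (cong (_+ r) z+k≡d)))
                    (f-peel m r (subst (r ≤_) r+q≡d' (m≤m+n r q)))

    -- Both pieces end before d: exchange for f at block m, followed by the top exchange.
    below : ∀ z p q → z + p + q ≡ T → z + p ≤ d → z + q ≤ d → f (z + p) + f (z + q) ≤ f T + f z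
    below z p q sum z+p≤d z+q≤d with m≤n⇒∃[o]m+o≡n d'≤p | m≤n⇒∃[o]m+o≡n d'≤q
      where
      d'≤p : d' ≤ p
      d'≤p = +-cancelˡ-≤ d d' p (subst (_≤ d + p) (trans (xy∙z≈xz∙y z q p) sum) (+-monoˡ-≤ p z+q≤d))
      d'≤q : d' ≤ q
      d'≤q = +-cancelˡ-≤ d d' q (subst (_≤ d + q) sum (+-monoˡ-≤ q z+p≤d))
    ... | p' , refl | q' , refl = begin
      f (z + (d' + p')) + f (z + (d' + q'))     ≡⟨ sym (cong₂ _+_ (cong f (+-assoc z d' p')) (cong f (+-assoc z d' q'))) ⟩
      f (z + d' + p') + f (z + d' + q')         ≤⟨ exchange-m (z + d') p' q' z+d'+p'+q'≡d ⟩
      f d + f (z + d')                          ≤⟨ top-m z (d' + p' + q') (trans (regroup′ z d' p' q') z+d'+p'+q'≡d) ⟩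
      f T + f z                                 ∎
      where
      regroup : ∀ z d' p' q' → z + d' + p' + q' + d' ≡ z + (d' + p') + (d' + q')
      regroup = solve-∀
      regroup′ : ∀ z d' p' q' → z + (d' + p' + q') ≡ z + d' + p' + q'
      regroup′ = solve-∀
      z+d'+p'+q'≡d : z + d' + p' + q' ≡ d
      z+d'+p'+q'≡d = +-cancelʳ-≡ d' _ _ (trans (regroup z d' p' q') sum)

    reaches : ∀ {z k x} → z + k ≡ d → d ≤ z + x → k ≤ x
    reaches {z} {k} {x} z+k≡d d≤z+x = +-cancelˡ-≤ z k x (subst (_≤ z + x) (sym z+k≡d) d≤z+x)

    falls-short : ∀ {z k x} → z + k ≡ d → z + x ≤ d → x ≤ k
    falls-short {z} {k} {x} z+k≡d z+x≤d = +-cancelˡ-≤ z x k (subst (z + x ≤_) (sym z+k≡d) z+x≤d)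

    f-exchange-suc : ExchangeAt f T
    f-exchange-suc z p q sum with d ≤? z
    ... | yes d≤z with m≤n⇒∃[o]m+o≡n d≤z
    ...   | w , refl = above w p q (+-cancelˡ-≡ d _ _ (trans (regroup d w p q) sum))
      where
      regroup : ∀ d w p q → d + (w + p + q) ≡ d + w + p + q
      regroup = solve-∀
    f-exchange-suc z p q sum | no d≰z with m≤n⇒∃[o]m+o≡n (<⇒≤ (≰⇒> d≰z))
    ...   | k , z+k≡d with d ≤? z + p | d ≤? z + q
    ...     | yes d≤z+p | yes d≤z+q =
      straddle z p q k sum z+k≡d (reaches z+k≡d d≤z+p) (reaches z+k≡d d≤z+q)
    ...     | yes d≤z+p | no d≰z+q =
      one-side z p q k sum z+k≡d (reaches z+k≡d d≤z+p) (falls-short z+k≡d (<⇒≤ (≰⇒> d≰z+q)))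
    ...     | no d≰z+p | yes d≤z+q =
      subst₂ _≤_ (+-comm (f (z + q)) (f (z + p))) refl
        (one-side z q p k (trans (xy∙z≈xz∙y z q p) sum) z+k≡d
                  (reaches z+k≡d d≤z+q) (falls-short z+k≡d (<⇒≤ (≰⇒> d≰z+p))))
    ...     | no d≰z+p | no d≰z+q = below z p q sum (<⇒≤ (≰⇒> d≰z+p)) (<⇒≤ (≰⇒> d≰z+q))

  c₂-zero : c₂ 0 ≡ 0
  c₂-zero = k>n⇒nCk≡0 (z<s {suc j})

  f-block-laws : ∀ n → CrossExchange f g (c₂ n) (c₁ n) × ExchangeAt f (c₂ n)
  f-block-laws zero =
    subst (λ total → CrossExchange f g total (c₁ 0)) (sym c₂-zero) (cross-exchange-at-zero f g (c₁ 0)) ,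
    subst (ExchangeAt f) (sym c₂-zero) (exchange-at-zero f)
  f-block-laws (suc m) =
    let cross , exchange = f-block-laws m
        top = f-top m exchange cross
    in subst₂ (CrossExchange f g) (sym (c₂-suc m)) (sym (c₁-suc m)) (f-cross-suc m top) ,
       subst (ExchangeAt f) (sym (c₂-suc m)) (ExchangeSuc.f-exchange-suc m exchange cross top)

  f-exchange : ∀ n → ExchangeAt f (c₂ n)
  f-exchange n = proj₂ (f-block-laws n)

  f≤g-binomial : ∀ n → f (c₂ n) ≤ g (c₂ n)
  f≤g-binomial zero = ≤-trans (≤-reflexive (cong f c₂-zero)) z≤n
  f≤g-binomial (suc n) = begin
    f (c₂ (suc n))           ≡⟨ cong f (c₂-suc n) ⟩
    f (c₂ n + c₁ n)          ≡⟨ f-peel n (c₁ n) ≤-refl ⟩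
    f (c₂ n) + g (c₁ n)      ≤⟨ +-monoˡ-≤ (g (c₁ n)) (f≤g-binomial n) ⟩
    g (c₂ n) + g (c₁ n)      ≤⟨ g-superadditive (c₂ n) (c₁ n) ⟩
    g (c₂ n + c₁ n)          ≡⟨ cong g (sym (c₂-suc n)) ⟩
    g (c₂ (suc n))           ∎
    where open ≤-Reasoning

  f≤g : ∀ b → f b ≤ g b
  f≤g b with greedy-split (suc j) b
  ... | n , r , b≡c₂+r , r<c₁ = begin
    f b                      ≡⟨ cong f b≡c₂+r ⟩
    f (c₂ n + r)             ≡⟨ f-peel n r (<⇒≤ r<c₁) ⟩
    f (c₂ n) + g r           ≤⟨ +-monoˡ-≤ (g r) (f≤g-binomial n) ⟩
    g (c₂ n) + g r           ≤⟨ g-superadditive (c₂ n) r ⟩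
    g (c₂ n + r)             ≡⟨ cong g (sym b≡c₂+r) ⟩
    g b                      ∎
    where open ≤-Reasoning

  -- Write a = c₂ n + r greedily.
  -- If r + b stays in block n, superadditivity of g and f ≤ g suffice; otherwise
  -- a + b = c₂ (n+1) + t with t < b, and exchange at c₂ (n+1) reduces to the pair (c₂ (n+1), t).
  f-superadditive-≤ : ∀ b a → b ≤ a → f a + f b ≤ f (a + b)
  f-superadditive-≤ = <-rec Goal superadditive
    where
    open ≤-Reasoning
    Goal : ℕ → Set
    Goal b = ∀ a → b ≤ a → f a + f b ≤ f (a + b)
    superadditive : ∀ b → (∀ {b'} → b' < b → Goal b') → Goal b
    superadditive b rec a b≤a with greedy-split (suc j) a
    ... | n , r , a≡c₂+r , r<c₁ with r + b ≤? c₁ n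
    ...   | yes r+b≤c₁ = begin
      f a + f b                ≡⟨ cong (_+ f b) (trans (cong f a≡c₂+r) (f-peel n r (<⇒≤ r<c₁))) ⟩
      f (c₂ n) + g r + f b     ≤⟨ +-monoʳ-≤ (f (c₂ n) + g r) (f≤g b) ⟩
      f (c₂ n) + g r + g b     ≡⟨ +-assoc (f (c₂ n)) (g r) (g b) ⟩
      f (c₂ n) + (g r + g b)   ≤⟨ +-monoʳ-≤ (f (c₂ n)) (g-superadditive r b) ⟩
      f (c₂ n) + g (r + b)     ≡⟨ sym (f-peel n (r + b) r+b≤c₁) ⟩
      f (c₂ n + (r + b))       ≡⟨ cong f (trans (sym (+-assoc (c₂ n) r b)) (cong (_+ b) (sym a≡c₂+r))) ⟩
      f (a + b)                ∎
    ...   | no r+b≰c₁ =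
      let t , c₁+t≡r+b = m≤n⇒∃[o]m+o≡n (<⇒≤ (≰⇒> r+b≰c₁))
          N = c₂ n + c₁ n
          a+b≡N+t = begin-equality
            a + b                ≡⟨ cong (_+ b) a≡c₂+r ⟩
            c₂ n + r + b         ≡⟨ +-assoc (c₂ n) r b ⟩
            c₂ n + (r + b)       ≡⟨ cong (c₂ n +_) (sym c₁+t≡r+b) ⟩
            c₂ n + (c₁ n + t)    ≡⟨ sym (+-assoc (c₂ n) (c₁ n) t) ⟩
            N + t                ∎
          t<b = +-cancelˡ-< (c₁ n) t b (subst (_< c₁ n + b) (sym c₁+t≡r+b) (+-monoˡ-< b r<c₁))
          t≤a = ≤-trans (<⇒≤ t<b) b≤a
          a≤N = subst₂ _≤_ (sym a≡c₂+r) refl (+-monoʳ-≤ (c₂ n) (<⇒≤ r<c₁))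
          P , t+P≡a = m≤n⇒∃[o]m+o≡n t≤a
          R , t+R≡b = m≤n⇒∃[o]m+o≡n (<⇒≤ t<b)
          t+P+R≡N = +-cancelʳ-≡ t _ N
            (trans (regroup t P R) (trans (cong₂ _+_ t+P≡a t+R≡b) a+b≡N+t))
          exchange-N = subst (ExchangeAt f) (c₂-suc n) (f-exchange (suc n))
      in begin
      f a + f b                ≡⟨ sym (cong₂ _+_ (cong f t+P≡a) (cong f t+R≡b)) ⟩
      f (t + P) + f (t + R)    ≤⟨ exchange-N t P R t+P+R≡N ⟩
      f N + f t                ≤⟨ rec t<b N (≤-trans t≤a a≤N) ⟩
      f (N + t)                ≡⟨ cong f (sym a+b≡N+t) ⟩
      f (a + b)                ∎
      where
      regroup : ∀ t P R → t + P + R + t ≡ (t + P) + (t + R)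
      regroup = solve-∀

  f-superadditive : Superadditive f
  f-superadditive a b with ≤-total b a
  ... | inj₁ b≤a = f-superadditive-≤ b a b≤a
  ... | inj₂ a≤b = subst₂ _≤_ (+-comm (f b) (f a)) (cong f (+-comm b a)) (f-superadditive-≤ a b a≤b)

boundary-laws : ∀ j → Superadditive (upper (suc j)) × (∀ n → ExchangeAt (upper (suc j)) (n C suc j))
boundary-laws zero = exchange⇒superadditive (upper 1) refl upper-one-exchange , λ n → upper-one-exchange (n C 1)
boundary-laws (suc j) =
  let superadditive , exchange = boundary-laws j
  in NextLevel.f-superadditive j superadditive exchange , NextLevel.f-exchange j superadditive exchange

upper-superadditive : ∀ j → Superadditive (upper (suc j))
upper-superadditive j = proj₁ (boundary-laws j)

-- Lemma 2: superadditivity at level i - 1, then peeling off C(N,i), which is admissible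
-- because m₁ + m₂ ≤ C(N,i-1).
lemma2 : (m₁ m₂ N i : ℕ) → m₁ ≥ 1 → m₂ ≥ 1 → N ≥ 1 → i ≥ 2 →
         m₁ + m₂ ≤ N C (i ∸ 1) →
         (m₁ + m₂ + N C i) ^⟨ i ⟩ ≥ m₁ ^⟨ i ∸ 1 ⟩ + m₂ ^⟨ i ∸ 1 ⟩ + N C (1 + i)
lemma2 m₁ m₂ N (suc (suc i)) _ _ _ (s≤s (s≤s z≤n)) m₁+m₂≤C = begin
  upper (suc i) m₁ + upper (suc i) m₂ + N C (3 + i)
    ≤⟨ +-monoˡ-≤ (N C (3 + i)) (upper-superadditive i m₁ m₂) ⟩
  upper (suc i) (m₁ + m₂) + N C (3 + i)
    ≡⟨ +-comm (upper (suc i) (m₁ + m₂)) _ ⟩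
  N C (3 + i) + upper (suc i) (m₁ + m₂)
    ≡⟨ sym (upper-peel≤ i N (m₁ + m₂) m₁+m₂≤C) ⟩
  upper (2 + i) (N C (2 + i) + (m₁ + m₂))
    ≡⟨ cong (upper (2 + i)) (+-comm (N C (2 + i)) (m₁ + m₂)) ⟩
  upper (2 + i) (m₁ + m₂ + N C (2 + i))
    ∎
  where open ≤-Reasoning
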